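{- Let $\mathcal D,\mathcal C\subseteq\mathcal U^{|z|}$ with $\mathcal C\equiv\mathcal D$, and let $\varphi(x,z)\in L$. If $\mathcal D$ is approximable by $\varphi(x,z)$ then so is $\mathcal C$. The same holds for approximability from below by $\varphi(x,z)$ and for approximability from above by $\varphi(x,z)$.
   Context: $\mathcal U$ is a saturated model of a first-order signature $L$, of uncountable inaccessible cardinality $\kappa>|L|$; $z$ is a finite tuple of variables. $\mathcal C\equiv\mathcal D$ means $\varphi(\mathcal C)\leftrightarrow\varphi(\mathcal D)$ for every sentence $\varphi(\mathcal X)$ built from $L$ (no parameters) and atomic formulas $t\in\mathcal X$ ($\mathcal X$ a second-order variable of arity $|z|$) using first-order connectives and quantifiers; equivalently $\langle\mathcal U,\mathcal C\rangle\equiv\langle\mathcal U,\mathcal D\rangle$. For a tuple $b$ and $B\subseteq\mathcal U$, $\varphi(b,B)=\{c\in B^{|z|}:\models\varphi(b,c)\}$. $\mathcal D$ is approximable by $\varphi(x,z)$ if for every finite $B\subseteq\mathcal U$ there is $b\in\mathcal U^{|x|}$ with $\varphi(b,B)=\mathcal D\cap B^{|z|}$; approximable from below (resp. from above) by $\varphi$ if moreover such $b$ can always be chosen with $\varphi(b,\mathcal U)\subseteq\mathcal D$ (resp. $\mathcal D\subseteq\varphi(b,\mathcal U)$). -}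

module Defs where

open import Data.Nat using (ℕ; zero; suc; _+_)
open import Data.Fin using (Fin)
open import Data.Vec using (Vec; []; _∷_; lookup; _++_)
open import Data.Vec.Relation.Unary.All using (All)
open import Data.List using (List)
open import Data.List.Membership.Propositional using (_∈_)
open import Data.Maybe using (Maybe; just; nothing)
open import Data.Product using (Σ; _×_; _,_)
open import Data.Sum using (_⊎_)
open import Data.Empty using (⊥)
open import Data.Unit using (⊤)
open import Function.Bundles using (_⇔_)
open import Relation.Binary.PropositionalEquality using (_≡_)

-- First-order signatures (constants = 0-ary function symbols)

record Signature : Set₁ where
  field
    FunSym   : Set
    funArity : FunSym → ℕ
    RelSym   : Set
    relArity : RelSym → ℕ
open Signature public

record Structure (L : Signature) : Set₁ where
  field
    Carrier : Set
    funI    : (f : FunSym L) → Vec Carrier (funArity L f) → Carrier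
    relI    : (r : RelSym L) → Vec Carrier (relArity L r) → Set
open Structure public

data Term (L : Signature) (n : ℕ) : Set where
  var : Fin n → Term L n
  app : (f : FunSym L) → Vec (Term L n) (funArity L f) → Term L n

-- The index  s : Maybe ℕ  records whether
-- a second-order variable X is available: nothing = plain L-formula,
-- just k = formulas which may also use atoms  t ∈ X  with X of arity k.
data Formula (L : Signature) : Maybe ℕ → ℕ → Set where
  _≐_  : ∀ {s n} → Term L n → Term L n → Formula L s n
  rel  : ∀ {s n} (r : RelSym L) → Vec (Term L n) (relArity L r) → Formula L s n
  mem  : ∀ {k n} → Vec (Term L n) k → Formula L (just k) n
  ⊥̇    : ∀ {s n} → Formula L s n
  _∧̇_  : ∀ {s n} → Formula L s n → Formula L s n → Formula L s n
  _∨̇_  : ∀ {s n} → Formula L s n → Formula L s n → Formula L s n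
  _⇒̇_  : ∀ {s n} → Formula L s n → Formula L s n → Formula L s n
  ∀̇    : ∀ {s n} → Formula L s (suc n) → Formula L s n
  ∃̇    : ∀ {s n} → Formula L s (suc n) → Formula L s n

LFormula : Signature → ℕ → Set
LFormula L n = Formula L nothing n

XSentence : Signature → ℕ → Set
XSentence L k = Formula L (just k) 0

module _ {L : Signature} (M : Structure L) where

  XInterp : Maybe ℕ → Set₁
  XInterp nothing  = Data.Unit.Polymorphic.⊤
    where import Data.Unit.Polymorphic
  XInterp (just k) = Vec (Carrier M) k → Set

  mutual
    evalT : ∀ {n} → Vec (Carrier M) n → Term L n → Carrier M
    evalT ρ (var i)    = lookup ρ i
    evalT ρ (app f ts) = funI M f (evalTs ρ ts)

    evalTs : ∀ {n m} → Vec (Carrier M) n → Vec (Term L n) m → Vec (Carrier M) m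
    evalTs ρ []       = []
    evalTs ρ (t ∷ ts) = evalT ρ t ∷ evalTs ρ ts

  Sat : ∀ {s n} → XInterp s → Formula L s n → Vec (Carrier M) n → Set
  Sat X (t ≐ u)   ρ = evalT ρ t ≡ evalT ρ u
  Sat X (rel r ts) ρ = relI M r (evalTs ρ ts)
  Sat X (mem ts)  ρ = X (evalTs ρ ts)
  Sat X ⊥̇         ρ = ⊥
  Sat X (φ ∧̇ ψ)   ρ = Sat X φ ρ × Sat X ψ ρ
  Sat X (φ ∨̇ ψ)   ρ = Sat X φ ρ ⊎ Sat X ψ ρ
  Sat X (φ ⇒̇ ψ)   ρ = Sat X φ ρ → Sat X ψ ρ
  Sat X (∀̇ φ)     ρ = (a : Carrier M) → Sat X φ (a ∷ ρ)
  Sat X (∃̇ φ)     ρ = Σ (Carrier M) λ a → Sat X φ (a ∷ ρ)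

  Holds : ∀ {m k} → LFormula L (m + k) → Vec (Carrier M) m → Vec (Carrier M) k → Set
  Holds φ b c = Sat _ φ (b ++ c)

  ElemEquiv : ∀ {k} → (Vec (Carrier M) k → Set) → (Vec (Carrier M) k → Set) → Set
  ElemEquiv {k} C D = (σ : XSentence L k) → Sat C σ [] ⇔ Sat D σ []

  TupleIn : ∀ {k} → List (Carrier M) → Vec (Carrier M) k → Set
  TupleIn B c = All (_∈ B) c

  TraceEq : ∀ {m k} → LFormula L (m + k) → (Vec (Carrier M) k → Set)
          → List (Carrier M) → Vec (Carrier M) m → Set
  TraceEq φ D B b = ∀ c → TupleIn B c → (Holds φ b c ⇔ D c)

  Approximable : ∀ {m k} → LFormula L (m + k) → (Vec (Carrier M) k → Set) → Set
  Approximable {m} φ D =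
    (B : List (Carrier M)) → Σ (Vec (Carrier M) m) λ b → TraceEq φ D B b

  ApproximableBelow : ∀ {m k} → LFormula L (m + k) → (Vec (Carrier M) k → Set) → Set
  ApproximableBelow {m} φ D =
    (B : List (Carrier M)) → Σ (Vec (Carrier M) m) λ b →
      TraceEq φ D B b × (∀ c → Holds φ b c → D c)

  ApproximableAbove : ∀ {m k} → LFormula L (m + k) → (Vec (Carrier M) k → Set) → Set
  ApproximableAbove {m} φ D =
    (B : List (Carrier M)) → Σ (Vec (Carrier M) m) λ b →
      TraceEq φ D B b × (∀ c → D c → Holds φ b c)

-- That some x satisfying ψ has φ(x, B) = X ∩ Bᵏ is, for B of size n, expressed uniformly in an
-- enumeration y of B by the sentence ∀y ∃x (∀z (z ⊆ y → (φ(x,z) ↔ z ∈ X)) ∧ ψ(x)) about ⟨U, X⟩.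
-- Elementarily equivalent C and D satisfy the same such sentences, so approximability (ψ = ⊤)
-- transfers from D to C; the one-sided variants take for ψ the formulas ∀z (φ(x,z) → z ∈ X)
-- and ∀z (z ∈ X → φ(x,z)).
module Submission where

open import Defs
open import Level using (Level)
open import Data.Nat using (ℕ; zero; suc; _+_)
open import Data.Fin using (Fin; zero; suc; _↑ˡ_; _↑ʳ_; splitAt; lift)
open import Data.Vec using (Vec; []; _∷_; _++_; lookup; tabulate; toList; fromList)
open import Data.Vec.Properties using (lookup-++ˡ; lookup-++ʳ; lookup-splitAt; toList∘fromList)
open import Data.Vec.Relation.Unary.All as All using (All; []; _∷_)
open import Data.Vec.Relation.Unary.Any using (toSum; fromSum)
open import Data.Vec.Membership.Propositional using () renaming (_∈_ to _∈ᵥ_)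
open import Data.Vec.Membership.Propositional.Properties using (∈-toList⁺; ∈-toList⁻)
open import Data.List using (List; length)
open import Data.Maybe using (Maybe; just)
open import Data.Product using (Σ; _×_; _,_)
open import Data.Product.Function.NonDependent.Propositional using (_×-⇔_)
open import Data.Sum using ([_,_]′)
open import Data.Sum.Function.Propositional using (_⊎-⇔_)
open import Data.Sum.Properties using ([,]-∘; [,]-cong)
open import Function using (_∘_; id)
open import Function.Bundles using (_⇔_; mk⇔; Equivalence)
open import Function.Properties.Equivalence using ()
  renaming (refl to ⇔-refl; sym to ⇔-sym; trans to ⇔-trans)
open import Function.Related.Propositional using (≡⇒; equivalence)
open import Function.Related.TypeIsomorphisms using (→-cong-⇔; Related-cong)
open import Relation.Binary.PropositionalEquality
  using (_≡_; _≗_; refl; trans; cong; cong₂; subst; module ≡-Reasoning)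

open Equivalence using (to; from)

private
  variable
    a p q : Level
    j k m n n′ : ℕ
    s : Maybe ℕ

≡⇒⇔ : {A B : Set a} → A ≡ B → A ⇔ B
≡⇒⇔ = ≡⇒ {k = equivalence}

Π-cong-⇔ : {A : Set a} {P : A → Set p} {Q : A → Set q} →
           (∀ x → P x ⇔ Q x) → ((x : A) → P x) ⇔ ((x : A) → Q x)
Π-cong-⇔ P⇔Q = mk⇔ (λ f x → to (P⇔Q x) (f x)) (λ g x → from (P⇔Q x) (g x))

Σ-cong-⇔ : {A : Set a} {P : A → Set p} {Q : A → Set q} →
           (∀ x → P x ⇔ Q x) → Σ A P ⇔ Σ A Q
Σ-cong-⇔ P⇔Q = mk⇔ (λ (x , px) → x , to (P⇔Q x) px) (λ (x , qx) → x , from (P⇔Q x) qx)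

module _ {L : Signature} where

  mutual
    renameT : (Fin n → Fin n′) → Term L n → Term L n′
    renameT r (var i)    = var (r i)
    renameT r (app f ts) = app f (renameTs r ts)

    renameTs : (Fin n → Fin n′) → Vec (Term L n) j → Vec (Term L n′) j
    renameTs r []       = []
    renameTs r (t ∷ ts) = renameT r t ∷ renameTs r ts

  rename : (Fin n → Fin n′) → Formula L s n → Formula L s n′
  rename r (t ≐ u)    = renameT r t ≐ renameT r u
  rename r (rel R ts) = rel R (renameTs r ts)
  rename r (mem ts)   = mem (renameTs r ts)
  rename r ⊥̇          = ⊥̇
  rename r (φ ∧̇ ψ)    = rename r φ ∧̇ rename r ψ
  rename r (φ ∨̇ ψ)    = rename r φ ∨̇ rename r ψ
  rename r (φ ⇒̇ ψ)    = rename r φ ⇒̇ rename r ψ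
  rename r (∀̇ φ)      = ∀̇ (rename (lift 1 r) φ)
  rename r (∃̇ φ)      = ∃̇ (rename (lift 1 r) φ)

  embed : LFormula L n → Formula L s n
  embed (t ≐ u)    = t ≐ u
  embed (rel R ts) = rel R ts
  embed ⊥̇          = ⊥̇
  embed (φ ∧̇ ψ)    = embed φ ∧̇ embed ψ
  embed (φ ∨̇ ψ)    = embed φ ∨̇ embed ψ
  embed (φ ⇒̇ ψ)    = embed φ ⇒̇ embed ψ
  embed (∀̇ φ)      = ∀̇ (embed φ)
  embed (∃̇ φ)      = ∃̇ (embed φ)

  ⊤̇ : Formula L s n
  ⊤̇ = ⊥̇ ⇒̇ ⊥̇

  _⇔̇_ : Formula L s n → Formula L s n → Formula L s n
  φ ⇔̇ ψ = (φ ⇒̇ ψ) ∧̇ (ψ ⇒̇ φ)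

  ∀* : ∀ j → Formula L s (j + n) → Formula L s n
  ∀* zero    φ = φ
  ∀* (suc j) φ = ∀* j (∀̇ φ)

  ∃* : ∀ j → Formula L s (j + n) → Formula L s n
  ∃* zero    φ = φ
  ∃* (suc j) φ = ∃* j (∃̇ φ)

  _∈̇_ : Term L n → Vec (Term L n) j → Formula L s n
  t ∈̇ []       = ⊥̇
  t ∈̇ (u ∷ us) = (t ≐ u) ∨̇ (t ∈̇ us)

  _⊆̇_ : Vec (Term L n) k → Vec (Term L n) j → Formula L s n
  []       ⊆̇ us = ⊤̇
  (t ∷ ts) ⊆̇ us = (t ∈̇ us) ∧̇ (ts ⊆̇ us)

  vars : (Fin j → Fin n) → Vec (Term L n) j
  vars r = tabulate (var ∘ r)

module _ {L : Signature} (M : Structure L) where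

  private
    A = Carrier M

  record Agree (r : Fin n → Fin n′) (ρ : Vec A n′) (σ : Vec A n) : Set where
    constructor agree
    field lookup-agree : lookup ρ ∘ r ≗ lookup σ
  open Agree

  Agree-id : {ρ : Vec A n} → Agree id ρ ρ
  Agree-id = agree λ _ → refl

  Agree-lift : ∀ {r : Fin n → Fin n′} {ρ σ} x → Agree r ρ σ → Agree (lift 1 r) (x ∷ ρ) (x ∷ σ)
  Agree-lift x ag = agree λ { zero → refl ; (suc i) → lookup-agree ag i }

  Agree-∘ : ∀ {r : Fin n′ → Fin n} {r′ : Fin j → Fin n′} {ρ σ τ} →
            Agree r ρ σ → Agree r′ σ τ → Agree (r ∘ r′) ρ τ
  Agree-∘ ag ag′ = agree λ i → trans (lookup-agree ag _) (lookup-agree ag′ i)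

  Agree-↑ˡ : (x : Vec A m) (y : Vec A n) → Agree (_↑ˡ n) (x ++ y) x
  Agree-↑ˡ x y = agree (lookup-++ˡ x y)

  Agree-↑ʳ : (z : Vec A k) (ρ : Vec A n) → Agree (k ↑ʳ_) (z ++ ρ) ρ
  Agree-↑ʳ z ρ = agree (lookup-++ʳ z ρ)

  Agree-join : ∀ {f : Fin m → Fin n} {g : Fin k → Fin n} {ρ x z} →
               Agree f ρ x → Agree g ρ z → Agree ([ f , g ]′ ∘ splitAt m) ρ (x ++ z)
  Agree-join {m = m} {f = f} {g} {ρ} {x} {z} (agree agf) (agree agg) = agree λ i → begin
    lookup ρ ([ f , g ]′ (splitAt m i))              ≡⟨ [,]-∘ (lookup ρ) (splitAt m i) ⟩
    [ lookup ρ ∘ f , lookup ρ ∘ g ]′ (splitAt m i)   ≡⟨ [,]-cong agf agg (splitAt m i) ⟩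
    [ lookup x , lookup z ]′ (splitAt m i)           ≡⟨ lookup-splitAt m x z i ⟨
    lookup (x ++ z) i                                ∎
    where open ≡-Reasoning

  mutual
    evalT-rename : ∀ {r : Fin n → Fin n′} {ρ σ} → Agree r ρ σ → (t : Term L n) →
                   evalT M ρ (renameT r t) ≡ evalT M σ t
    evalT-rename ag (var i)    = lookup-agree ag i
    evalT-rename ag (app f ts) = cong (funI M f) (evalTs-rename ag ts)

    evalTs-rename : ∀ {r : Fin n → Fin n′} {ρ σ} → Agree r ρ σ → (ts : Vec (Term L n) j) →
                    evalTs M ρ (renameTs r ts) ≡ evalTs M σ ts
    evalTs-rename ag []       = refl
    evalTs-rename ag (t ∷ ts) = cong₂ _∷_ (evalT-rename ag t) (evalTs-rename ag ts)

  evalTs-vars : ∀ {r : Fin j → Fin n} {ρ σ} → Agree r ρ σ → evalTs M ρ (vars r) ≡ σ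
  evalTs-vars {σ = []}    ag = refl
  evalTs-vars {σ = _ ∷ _} (agree ag) = cong₂ _∷_ (ag zero) (evalTs-vars (agree (ag ∘ suc)))

  Sat-rename : (X : XInterp M s) {r : Fin n → Fin n′} {ρ : Vec A n′} {σ : Vec A n} →
               Agree r ρ σ → (φ : Formula L s n) → Sat M X (rename r φ) ρ ⇔ Sat M X φ σ
  Sat-rename X ag (t ≐ u)    = ≡⇒⇔ (cong₂ _≡_ (evalT-rename ag t) (evalT-rename ag u))
  Sat-rename X ag (rel R ts) = ≡⇒⇔ (cong (relI M R) (evalTs-rename ag ts))
  Sat-rename X ag (mem ts)   = ≡⇒⇔ (cong X (evalTs-rename ag ts))
  Sat-rename X ag ⊥̇          = ⇔-refl
  Sat-rename X ag (φ ∧̇ ψ)    = Sat-rename X ag φ ×-⇔ Sat-rename X ag ψ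
  Sat-rename X ag (φ ∨̇ ψ)    = Sat-rename X ag φ ⊎-⇔ Sat-rename X ag ψ
  Sat-rename X ag (φ ⇒̇ ψ)    = →-cong-⇔ (Sat-rename X ag φ) (Sat-rename X ag ψ)
  Sat-rename X ag (∀̇ φ)      = Π-cong-⇔ λ x → Sat-rename X (Agree-lift x ag) φ
  Sat-rename X ag (∃̇ φ)      = Σ-cong-⇔ λ x → Sat-rename X (Agree-lift x ag) φ

  Sat-embed : (X : XInterp M s) {ρ : Vec A n} (φ : LFormula L n) →
              Sat M X (embed φ) ρ ⇔ Sat M _ φ ρ
  Sat-embed X (t ≐ u)    = ⇔-refl
  Sat-embed X (rel R ts) = ⇔-refl
  Sat-embed X ⊥̇          = ⇔-refl
  Sat-embed X (φ ∧̇ ψ)    = Sat-embed X φ ×-⇔ Sat-embed X ψ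
  Sat-embed X (φ ∨̇ ψ)    = Sat-embed X φ ⊎-⇔ Sat-embed X ψ
  Sat-embed X (φ ⇒̇ ψ)    = →-cong-⇔ (Sat-embed X φ) (Sat-embed X ψ)
  Sat-embed X (∀̇ φ)      = Π-cong-⇔ λ _ → Sat-embed X φ
  Sat-embed X (∃̇ φ)      = Σ-cong-⇔ λ _ → Sat-embed X φ

  Sat-⇔̇ : (X : XInterp M s) {ρ : Vec A n} (φ ψ : Formula L s n) →
          Sat M X (φ ⇔̇ ψ) ρ ⇔ (Sat M X φ ρ ⇔ Sat M X ψ ρ)
  Sat-⇔̇ X φ ψ = mk⇔ (λ (f , g) → mk⇔ f g) (λ e → to e , from e)

  Sat-∀* : (X : XInterp M s) {ρ : Vec A n} (j : ℕ) (φ : Formula L s (j + n)) →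
           Sat M X (∀* j φ) ρ ⇔ ((v : Vec A j) → Sat M X φ (v ++ ρ))
  Sat-∀* X zero    φ = mk⇔ (λ { h [] → h }) (λ h → h [])
  Sat-∀* X (suc j) φ = ⇔-trans (Sat-∀* X j (∀̇ φ))
    (mk⇔ (λ { h (x ∷ v) → h v x }) (λ h v x → h (x ∷ v)))

  Sat-∃* : (X : XInterp M s) {ρ : Vec A n} (j : ℕ) (φ : Formula L s (j + n)) →
           Sat M X (∃* j φ) ρ ⇔ Σ (Vec A j) (λ v → Sat M X φ (v ++ ρ))
  Sat-∃* X zero    φ = mk⇔ ([] ,_) (λ { ([] , h) → h })
  Sat-∃* X (suc j) φ = ⇔-trans (Sat-∃* X j (∃̇ φ))
    (mk⇔ (λ (v , x , h) → x ∷ v , h) (λ { (x ∷ v , h) → v , x , h }))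

  Sat-∈̇ : (X : XInterp M s) {ρ : Vec A n} (t : Term L n) (us : Vec (Term L n) j) →
          Sat M X (t ∈̇ us) ρ ⇔ evalT M ρ t ∈ᵥ evalTs M ρ us
  Sat-∈̇ X t []       = mk⇔ (λ ()) (λ ())
  Sat-∈̇ X t (u ∷ us) = ⇔-trans (⇔-refl ⊎-⇔ Sat-∈̇ X t us) (mk⇔ fromSum toSum)

  Sat-⊆̇ : (X : XInterp M s) {ρ : Vec A n} (ts : Vec (Term L n) k) (us : Vec (Term L n) j) →
          Sat M X (ts ⊆̇ us) ρ ⇔ All (_∈ᵥ evalTs M ρ us) (evalTs M ρ ts)
  Sat-⊆̇ X []       us = mk⇔ (λ _ → []) (λ _ ())
  Sat-⊆̇ X (t ∷ ts) us = ⇔-trans (Sat-∈̇ X t us ×-⇔ Sat-⊆̇ X ts us)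
    (mk⇔ (λ (p , ps) → p ∷ ps) All.uncons)

  Sat-mem-vars : (X : XInterp M (just k)) {r : Fin k → Fin n} {ρ : Vec A n} {z : Vec A k} →
                 Agree r ρ z → Sat M X (mem (vars r)) ρ ⇔ X z
  Sat-mem-vars X ag = ≡⇒⇔ (cong X (evalTs-vars ag))

  Sat-vars-⊆̇-vars : (X : XInterp M s) {r : Fin k → Fin n} {r′ : Fin j → Fin n}
                     {ρ : Vec A n} {z : Vec A k} {y : Vec A j} →
                     Agree r ρ z → Agree r′ ρ y →
                     Sat M X (vars r ⊆̇ vars r′) ρ ⇔ TupleIn M (toList y) z
  Sat-vars-⊆̇-vars X {r} {r′} agz agy = ⇔-trans (Sat-⊆̇ X (vars r) (vars r′)) (⇔-trans
    (≡⇒⇔ (cong₂ (λ z y → All (_∈ᵥ y) z) (evalTs-vars agz) (evalTs-vars agy)))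
    (mk⇔ (All.map ∈-toList⁺) (All.map ∈-toList⁻)))

module Approximation {L : Signature} (M : Structure L) {m k : ℕ} (φ : LFormula L (m + k)) where

  private
    A = Carrier M

  -- φ(x, z) in a context whose first k variables are z, the variables x sitting at ι.
  φ⟨_⟩ : (Fin m → Fin n) → Formula L (just k) (k + n)
  φ⟨_⟩ {n} ι = rename ([ (k ↑ʳ_) ∘ ι , _↑ˡ n ]′ ∘ splitAt m) (embed φ)

  zvars : Vec (Term L (k + n)) k
  zvars {n} = vars (_↑ˡ n)

  Sat-φ⟨⟩ : (X : XInterp M (just k)) {ι : Fin m → Fin n} {ρ : Vec A n} {x : Vec A m} (z : Vec A k) →
            Agree M ι ρ x → Sat M X φ⟨ ι ⟩ (z ++ ρ) ⇔ Holds M φ x z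
  Sat-φ⟨⟩ X {ρ = ρ} z ag = ⇔-trans
    (Sat-rename M X (Agree-join M (Agree-∘ M (Agree-↑ʳ M z ρ) ag) (Agree-↑ˡ M z ρ)) (embed φ))
    (Sat-embed M X φ)

  Sat-mem-zvars : (X : XInterp M (just k)) (z : Vec A k) (ρ : Vec A n) →
                  Sat M X (mem zvars) (z ++ ρ) ⇔ X z
  Sat-mem-zvars X z ρ = Sat-mem-vars M X (Agree-↑ˡ M z ρ)

  below above : Formula L (just k) m
  below = ∀* k (φ⟨ id ⟩ ⇒̇ mem zvars)
  above = ∀* k (mem zvars ⇒̇ φ⟨ id ⟩)

  Sat-below : (X : XInterp M (just k)) (x : Vec A m) →
              Sat M X below x ⇔ (∀ c → Holds M φ x c → X c)
  Sat-below X x = ⇔-trans (Sat-∀* M X k _) (Π-cong-⇔ λ c →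
    →-cong-⇔ (Sat-φ⟨⟩ X c (Agree-id M)) (Sat-mem-zvars X c x))

  Sat-above : (X : XInterp M (just k)) (x : Vec A m) →
              Sat M X above x ⇔ (∀ c → X c → Holds M φ x c)
  Sat-above X x = ⇔-trans (Sat-∀* M X k _) (Π-cong-⇔ λ c →
    →-cong-⇔ (Sat-mem-zvars X c x) (Sat-φ⟨⟩ X c (Agree-id M)))

  ApproximableWith : Formula L (just k) m → (Vec A k → Set) → Set
  ApproximableWith ψ X =
    (B : List A) → Σ (Vec A m) λ x → TraceEq M φ X B x × Sat M X ψ x

  -- The context of traceBody is z ++ x ++ y ++ [] for the tuple z, the parameter x and
  -- an enumeration y of B.
  yvars : ∀ n → Vec (Term L (k + (m + (n + 0)))) n
  yvars n = vars ((k ↑ʳ_) ∘ (m ↑ʳ_) ∘ (_↑ˡ 0))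

  traceBody : ∀ n → Formula L (just k) (k + (m + (n + 0)))
  traceBody n = (zvars ⊆̇ yvars n) ⇒̇ (φ⟨ _↑ˡ (n + 0) ⟩ ⇔̇ mem zvars)

  traceSentence : Formula L (just k) m → ℕ → XSentence L k
  traceSentence ψ n = ∀* n (∃* m (∀* k (traceBody n) ∧̇ rename (_↑ˡ (n + 0)) ψ))

  Sat-traceBody : (X : XInterp M (just k)) (y : Vec A n) (x : Vec A m) (z : Vec A k) →
    Sat M X (traceBody n) (z ++ x ++ y ++ []) ⇔ (TupleIn M (toList y) z → (Holds M φ x z ⇔ X z))
  Sat-traceBody {n} X y x z = →-cong-⇔
    (Sat-vars-⊆̇-vars M X (Agree-↑ˡ M z xy)
      (Agree-∘ M (Agree-↑ʳ M z xy) (Agree-∘ M (Agree-↑ʳ M x (y ++ [])) (Agree-↑ˡ M y []))))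
    (⇔-trans (Sat-⇔̇ M X φ⟨ _↑ˡ (n + 0) ⟩ (mem zvars))
      (Related-cong (Sat-φ⟨⟩ X z (Agree-↑ˡ M x (y ++ []))) (Sat-mem-zvars X z xy)))
    where
      xy : Vec A (m + (n + 0))
      xy = x ++ y ++ []

  Sat-traceSentence : (X : XInterp M (just k)) (ψ : Formula L (just k) m) (n : ℕ) →
    Sat M X (traceSentence ψ n) [] ⇔
    ((y : Vec A n) → Σ (Vec A m) λ x → TraceEq M φ X (toList y) x × Sat M X ψ x)
  Sat-traceSentence X ψ n = ⇔-trans (Sat-∀* M X n _) (Π-cong-⇔ λ y →
    ⇔-trans (Sat-∃* M X m _) (Σ-cong-⇔ λ x →
      ⇔-trans (Sat-∀* M X k _) (Π-cong-⇔ (Sat-traceBody X y x))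
      ×-⇔ Sat-rename M X (Agree-↑ˡ M x (y ++ [])) ψ))

  ApproximableWith-transfer : {C D : Vec A k → Set} (ψ : Formula L (just k) m) →
    ElemEquiv M C D → ApproximableWith ψ D → ApproximableWith ψ C
  ApproximableWith-transfer {C} {D} ψ C≡D approxD B =
    subst (λ B′ → Σ (Vec A m) λ x → TraceEq M φ C B′ x × Sat M C ψ x) (toList∘fromList B)
          (to (Sat-traceSentence C ψ (length B)) satC (fromList B))
    where
      satC : Sat M C (traceSentence ψ (length B)) []
      satC = from (C≡D (traceSentence ψ (length B)))
                  (from (Sat-traceSentence D ψ (length B)) (approxD ∘ toList))

  Approximable⇔With-⊤̇ : (X : Vec A k → Set) → Approximable M φ X ⇔ ApproximableWith ⊤̇ X
  Approximable⇔With-⊤̇ X = Π-cong-⇔ λ B →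
    mk⇔ (λ (x , trace) → x , trace , id) (λ (x , trace , _) → x , trace)

  ApproximableBelow⇔With-below : (X : Vec A k → Set) →
    ApproximableBelow M φ X ⇔ ApproximableWith below X
  ApproximableBelow⇔With-below X = Π-cong-⇔ λ B → Σ-cong-⇔ λ x → ⇔-refl ×-⇔ ⇔-sym (Sat-below X x)

  ApproximableAbove⇔With-above : (X : Vec A k → Set) →
    ApproximableAbove M φ X ⇔ ApproximableWith above X
  ApproximableAbove⇔With-above X = Π-cong-⇔ λ B → Σ-cong-⇔ λ x → ⇔-refl ×-⇔ ⇔-sym (Sat-above X x)

proposition2p5 : (L : Signature) (U : Structure L) (m k : ℕ)
    (φ : LFormula L (m + k)) (C D : Vec (Carrier U) k → Set) →
    ElemEquiv U C D →
    (Approximable U φ D → Approximable U φ C)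
    × (ApproximableBelow U φ D → ApproximableBelow U φ C)
    × (ApproximableAbove U φ D → ApproximableAbove U φ C)
proposition2p5 L U m k φ C D C≡D =
    transfer ⊤̇ Approximable⇔With-⊤̇
  , transfer below ApproximableBelow⇔With-below
  , transfer above ApproximableAbove⇔With-above
  where
    open Approximation U {m} {k} φ
    transfer : {P : (Vec (Carrier U) k → Set) → Set} (ψ : Formula L (just k) m) →
               (∀ X → P X ⇔ ApproximableWith ψ X) → P D → P C
    transfer ψ P⇔ = from (P⇔ C) ∘ ApproximableWith-transfer ψ C≡D ∘ to (P⇔ D)
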